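{- Suppose $(G,M)$ admits an augmenting path and let $2\ell+1$ be the length of a shortest one. Then every shortest augmenting path $X$ of $(G,M)$ contains no edge $e$ with $\mathsf{vlevel}(e)>2\ell+5$, and contains no vertex $v$ with $\mathrm{dist}^{\alpha}(v)>\ell+2$.
   Context: $G$ finite simple graph, $M$ a matching, $U$ the $M$-uncovered vertices. An augmenting path of $(G,M)$ is a simple path in $G$ between two distinct vertices of $U$ whose edges alternate between non-matching and matching edges, starting and ending with non-matching edges. $G^+$: add vertex $f$ and for each $u\in U$ a vertex $w_u$ with edges $\{f,w_u\},\{w_u,u\}$; $M^+=M\cup\{\{w_u,u\}\}$. Alternating path: simple path in $G^+$ alternating between $M^+$ and non-$M^+$ edges. $\mathrm{dist}^\theta(v)$: minimum length of an alternating $f$–$v$ path of parity $\theta\in\{\mathrm{odd},\mathrm{even}\}$ ($\infty$ if none); $\mathrm{dist}^\alpha(v)$ is the minimum of the two. $\rho(e)=\mathrm{odd}$ if $e\in M^+$, else even. $\mathsf{vlevel}(\{y,z\})=\mathrm{dist}^{\rho(\{y,z\})}(y)+\mathrm{dist}^{\rho(\{y,z\})}(z)+1$. -}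

module Defs where

open import Data.Nat using (ℕ; zero; suc; _+_; _≤_; _<_)
open import Data.Fin using (Fin)
open import Data.Bool using (Bool; true; false; T)
open import Data.Product using (Σ; _×_; _,_)
open import Relation.Nullary using (¬_)
open import Relation.Binary.PropositionalEquality using (_≡_)

record Graph (n : ℕ) : Set where
  field
    adj     : Fin n → Fin n → Bool
    adj-sym : ∀ x y → adj x y ≡ adj y x
    irrefl  : ∀ x → adj x x ≡ false

record Matching {n : ℕ} (G : Graph n) : Set where
  field
    m        : Fin n → Fin n → Bool
    m-sym    : ∀ x y → m x y ≡ m y x
    m⊆E      : ∀ x y → m x y ≡ true → Graph.adj G x y ≡ true
    m-unique : ∀ x y z → m x y ≡ true → m x z ≡ true → y ≡ z

module _ {n : ℕ} {G : Graph n} (M : Matching G) where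
  open Graph G
  open Matching M

  Uncovered : Fin n → Set
  Uncovered x = ∀ y → m x y ≡ false

  -- A path is given by a vertex sequence p 0, …, p k (length k = #edges).
  -- Augmenting path of (G,M) of length k.
  record AugPath (k : ℕ) : Set where
    field
      p        : ℕ → Fin n
      walk     : ∀ i → i < k → T (adj (p i) (p (suc i)))
      simple   : ∀ i j → i ≤ k → j ≤ k → p i ≡ p j → i ≡ j
      start-U  : Uncovered (p 0)
      end-U    : Uncovered (p k)
      distinct : ¬ (p 0 ≡ p k)
      alt      : ∀ i → suc (suc i) ≤ k →
                   (T (m (p i) (p (suc i))) → ¬ T (m (p (suc i)) (p (suc (suc i)))))
                 × (¬ T (m (p i) (p (suc i))) → T (m (p (suc i)) (p (suc (suc i)))))
      first-nm : ¬ T (m (p 0) (p 1))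
      last-nm  : ∀ j → suc j ≡ k → ¬ T (m (p j) (p k))

  -- The auxiliary graph G⁺ and matching M⁺.
  -- Vertices: f, w u (for u : Fin n; only those with u ∈ U are
  -- non-isolated), and the original vertices v x.
  data V⁺ : Set where
    f : V⁺
    w : Fin n → V⁺
    v : Fin n → V⁺

  data E⁺ : V⁺ → V⁺ → Set where
    old : ∀ {x y} → T (adj x y) → E⁺ (v x) (v y)
    fw  : ∀ {u} → Uncovered u → E⁺ f (w u)
    wf  : ∀ {u} → Uncovered u → E⁺ (w u) f
    wv  : ∀ {u} → Uncovered u → E⁺ (w u) (v u)
    vw  : ∀ {u} → Uncovered u → E⁺ (v u) (w u)

  data M⁺ : V⁺ → V⁺ → Set where
    old : ∀ {x y} → T (m x y) → M⁺ (v x) (v y)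
    wv  : ∀ {u} → Uncovered u → M⁺ (w u) (v u)
    vw  : ∀ {u} → Uncovered u → M⁺ (v u) (w u)

  record AltPath (t : V⁺) (k : ℕ) : Set where
    field
      p      : ℕ → V⁺
      start  : p 0 ≡ f
      end    : p k ≡ t
      walk   : ∀ i → i < k → E⁺ (p i) (p (suc i))
      simple : ∀ i j → i ≤ k → j ≤ k → p i ≡ p j → i ≡ j
      alt    : ∀ i → suc (suc i) ≤ k →
                 (M⁺ (p i) (p (suc i)) → ¬ M⁺ (p (suc i)) (p (suc (suc i))))
               × (¬ M⁺ (p i) (p (suc i)) → M⁺ (p (suc i)) (p (suc (suc i))))

data Parity : Set where
  odd even : Parity

parity : ℕ → Parity
parity zero = even
parity (suc zero) = odd
parity (suc (suc k)) = parity k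

data ℕ∞ : Set where
  fin : ℕ → ℕ∞
  ∞   : ℕ∞

_+∞_ : ℕ∞ → ℕ∞ → ℕ∞
fin a +∞ fin b = fin (a + b)
fin a +∞ ∞ = ∞
∞ +∞ _ = ∞

min∞ : ℕ∞ → ℕ∞ → ℕ∞
min∞ (fin a) (fin b) = fin (Data.Nat._⊓_ a b)
  where import Data.Nat
min∞ (fin a) ∞ = fin a
min∞ ∞ y = y

_<∞_ : ℕ → ℕ∞ → Set
N <∞ fin d = N < d
N <∞ ∞ = Data.Unit.⊤
  where import Data.Unit

module _ {n : ℕ} {G : Graph n} (M : Matching G) where
  open Matching M

  data IsDist (θ : Parity) (t : V⁺ M) : ℕ∞ → Set where
    finite : ∀ k → AltPath M t k → parity k ≡ θ →
             (∀ k′ → AltPath M t k′ → parity k′ ≡ θ → k ≤ k′) →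
             IsDist θ t (fin k)
    none   : (∀ k → AltPath M t k → ¬ (parity k ≡ θ)) → IsDist θ t ∞

  IsDistα : V⁺ M → ℕ∞ → Set
  IsDistα t d = Σ ℕ∞ λ d₁ → Σ ℕ∞ λ d₂ →
                  IsDist odd t d₁ × IsDist even t d₂ × d ≡ min∞ d₁ d₂

  ρ : Fin n → Fin n → Parity
  ρ x y with m x y
  ... | true  = odd
  ... | false = even

  IsVlevel : Fin n → Fin n → ℕ∞ → Set
  IsVlevel x y L = Σ ℕ∞ λ dx → Σ ℕ∞ λ dy →
                     IsDist (ρ x y) (v x) dx × IsDist (ρ x y) (v y) dy ×
                     L ≡ (dx +∞ dy) +∞ fin 1

-- Preceded by f and w x₀, an augmenting path x₀ … x_{2ℓ+1} gives an alternating f–xᵢ path of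
-- length i + 2 and parity i; read backwards from x_{2ℓ+1} (augmenting paths have odd length) it
-- gives one of length 2ℓ + 3 − i and the opposite parity. The shorter one bounds dist^α(xᵢ) by
-- ℓ + 2. For the edge {xᵢ, xᵢ₊₁}, whose ρ is the parity of i, the forward path to xᵢ and the
-- backward path to xᵢ₊₁ both have parity i, so vlevel ≤ (i + 2) + (2ℓ + 2 − i) + 1 = 2ℓ + 5.
{-# OPTIONS --safe #-}
module Submission where

open import Defs
open import Data.Nat using (ℕ; zero; suc; _+_; _*_; _∸_; _≤_; _<_; s≤s; _≤?_)
open import Data.Nat.Properties
  using (≤-refl; ≤-trans; ≤-reflexive; <⇒≤; <⇒≱; ≰⇒>; +-mono-≤; +-monoˡ-≤; +-comm; +-assoc;
         m⊓n≤m; m⊓n≤n; m∸n≤m; n∸n≡0; m∸n+n≡m; m∸[m∸n]≡n; +-∸-assoc; ∸-cancelˡ-≡; m≤n+o⇒m∸n≤o)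
open import Data.Nat.Tactic.RingSolver using (solve-∀)
open import Data.Bool using (Bool; true; false; not; T)
open import Data.Fin using (Fin)
open import Data.Product using (_×_; _,_)
open import Data.Empty using (⊥; ⊥-elim)
open import Data.Unit using (tt)
open import Function using (_∘_)
open import Function.Bundles using (_⇔_; mk⇔; Equivalence)
open import Relation.Nullary using (¬_; yes; no)
open import Relation.Binary.PropositionalEquality
  using (_≡_; refl; sym; trans; cong; subst; module ≡-Reasoning)

¬T⇒≡false : ∀ {b} → ¬ T b → b ≡ false
¬T⇒≡false {true}  ¬t = ⊥-elim (¬t tt)
¬T⇒≡false {false} _  = refl

Alternate : Set → Set → Set
Alternate A B = (A → ¬ B) × (¬ A → B)

Alternate-T⇒≡not : ∀ {b₁ b₂} → Alternate (T b₁) (T b₂) → b₂ ≡ not b₁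
Alternate-T⇒≡not {true}          (one , _)   = ¬T⇒≡false (one tt)
Alternate-T⇒≡not {false} {true}  _           = refl
Alternate-T⇒≡not {false} {false} (_ , other) = ⊥-elim (other (λ ()))

≡not⇒Alternate-T : ∀ {b₁ b₂} → b₂ ≡ not b₁ → Alternate (T b₁) (T b₂)
≡not⇒Alternate-T {true}  refl = (λ _ ()) , (λ ¬t → ⊥-elim (¬t tt))
≡not⇒Alternate-T {false} refl = (λ ()) , (λ _ → tt)

Alternate-resp-⇔ : ∀ {A A′ B B′ : Set} → A ⇔ A′ → B ⇔ B′ → Alternate A B → Alternate A′ B′
Alternate-resp-⇔ A⇔A′ B⇔B′ (one , other) =
  (λ a′ b′ → one (from A⇔A′ a′) (from B⇔B′ b′)) , (λ ¬a′ → to B⇔B′ (other (¬a′ ∘ to A⇔A′)))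
  where open Equivalence

isOdd : Parity → Bool
isOdd odd  = true
isOdd even = false

isOdd≡false⇒even : ∀ {θ} → isOdd θ ≡ false → θ ≡ even
isOdd≡false⇒even {even} _ = refl

isOdd-parity-suc : ∀ j → isOdd (parity (suc j)) ≡ not (isOdd (parity j))
isOdd-parity-suc zero          = refl
isOdd-parity-suc (suc zero)    = refl
isOdd-parity-suc (suc (suc j)) = isOdd-parity-suc j

parity-suc-even : ∀ k → parity k ≡ even → parity (suc k) ≡ odd
parity-suc-even zero          _ = refl
parity-suc-even (suc (suc k)) e = parity-suc-even k e

parity-pred-odd : ∀ k → parity (suc k) ≡ odd → parity k ≡ even
parity-pred-odd zero          _ = refl
parity-pred-odd (suc (suc k)) o = parity-pred-odd k o

parity-∸-suc : ∀ {k} j → parity k ≡ odd → j < k → parity (k ∸ suc j) ≡ parity j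
parity-∸-suc {suc k}       zero          o _                 = parity-pred-odd k o
parity-∸-suc {suc (suc k)} (suc zero)    o _                 = o
parity-∸-suc {suc (suc k)} (suc (suc j)) o (s≤s (s≤s j<k)) = parity-∸-suc j o j<k
parity-∸-suc {suc zero}    (suc _)       _ (s≤s ())

infix 4 _≤∞_

_≤∞_ : ℕ∞ → ℕ → Set
fin b ≤∞ a = b ≤ a
∞     ≤∞ a = ⊥

≤∞⇒≮∞ : ∀ {d a N} → d ≤∞ a → a ≤ N → ¬ (N <∞ d)
≤∞⇒≮∞ {fin b} b≤a a≤N N<b = <⇒≱ N<b (≤-trans b≤a a≤N)

+∞-mono-≤∞ : ∀ {d e a b} → d ≤∞ a → e ≤∞ b → d +∞ e ≤∞ a + b
+∞-mono-≤∞ {fin _} {fin _} = +-mono-≤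

min∞-≤∞ˡ : ∀ {d e a} → d ≤∞ a → min∞ d e ≤∞ a
min∞-≤∞ˡ {fin b} {fin c} b≤a = ≤-trans (m⊓n≤m b c) b≤a
min∞-≤∞ˡ {fin b} {∞}     b≤a = b≤a

min∞-≤∞ʳ : ∀ {d e a} → e ≤∞ a → min∞ d e ≤∞ a
min∞-≤∞ʳ {fin b} {fin c} c≤a = ≤-trans (m⊓n≤n b c) c≤a
min∞-≤∞ʳ {∞}             e≤a = e≤a

module _ {n : ℕ} {G : Graph n} (M : Matching G) where
  open Graph G
  open Matching M

  IsDist-≤∞ : ∀ {θ t d a} → IsDist M θ t d → AltPath M t a → parity a ≡ θ → d ≤∞ a
  IsDist-≤∞ (finite _ _ _ minimal) P e = minimal _ P e
  IsDist-≤∞ (none no-path)         P e = no-path _ P e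

  IsDistα-≤∞ : ∀ {t d a} → IsDistα M t d → AltPath M t a → d ≤∞ a
  IsDistα-≤∞ {a = a} (_ , _ , D₁ , D₂ , refl) P with parity a in e
  ... | odd  = min∞-≤∞ˡ (IsDist-≤∞ D₁ P e)
  ... | even = min∞-≤∞ʳ (IsDist-≤∞ D₂ P e)

  IsVlevel-≤∞ : ∀ {x y L a b} → IsVlevel M x y L →
                AltPath M (v x) a → AltPath M (v y) b →
                parity a ≡ ρ M x y → parity b ≡ ρ M x y → L ≤∞ a + b + 1
  IsVlevel-≤∞ (_ , _ , Dx , Dy , refl) P Q ea eb =
    +∞-mono-≤∞ (+∞-mono-≤∞ (IsDist-≤∞ Dx P ea) (IsDist-≤∞ Dy Q eb)) ≤-refl

  m≡isOdd⇒ρ≡ : ∀ {x y} θ → m x y ≡ isOdd θ → ρ M x y ≡ θ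
  m≡isOdd⇒ρ≡ {x} {y} θ e with m x y
  m≡isOdd⇒ρ≡ odd  e | true  = refl
  m≡isOdd⇒ρ≡ even e | false = refl

  M⁺-v⇔ : ∀ {x y} → T (m x y) ⇔ M⁺ M (v x) (v y)
  M⁺-v⇔ = mk⇔ old (λ { (old t) → t })

  -- The part in G of an alternating path of G⁺ from f: after the matched edge {w (p 0), p 0}
  -- alternation means that exactly the odd-numbered edges are matched.
  record AltPathFromUncovered (t : Fin n) (a : ℕ) : Set where
    field
      p       : ℕ → Fin n
      start-U : Uncovered M (p 0)
      end     : p a ≡ t
      walk    : ∀ j → j < a → T (adj (p j) (p (suc j)))
      simple  : ∀ i j → i ≤ a → j ≤ a → p i ≡ p j → i ≡ j
      matched : ∀ j → j < a → m (p j) (p (suc j)) ≡ isOdd (parity j)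

  take : ∀ {t a} (P : AltPathFromUncovered t a) i → i ≤ a →
         AltPathFromUncovered (AltPathFromUncovered.p P i) i
  take P i i≤a = record
    { p       = p
    ; start-U = start-U
    ; end     = refl
    ; walk    = λ j j<i → walk j (≤-trans j<i i≤a)
    ; simple  = λ j j′ j≤i j′≤i → simple j j′ (≤-trans j≤i i≤a) (≤-trans j′≤i i≤a)
    ; matched = λ j j<i → matched j (≤-trans j<i i≤a)
    }
    where open AltPathFromUncovered P

  toAltPath : ∀ {t a} → AltPathFromUncovered t a → AltPath M (v t) (2 + a)
  toAltPath {t} {a} P = record
    { p = p⁺ ; start = refl ; end = cong v end ; walk = walk⁺ ; simple = simple⁺ ; alt = alt⁺ }
    where
    open AltPathFromUncovered P

    p⁺ : ℕ → V⁺ M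
    p⁺ zero          = f
    p⁺ (suc zero)    = w (p 0)
    p⁺ (suc (suc j)) = v (p j)

    walk⁺ : ∀ i → i < 2 + a → E⁺ M (p⁺ i) (p⁺ (suc i))
    walk⁺ zero          _                 = fw start-U
    walk⁺ (suc zero)    _                 = wv start-U
    walk⁺ (suc (suc j)) (s≤s (s≤s j<a)) = old (walk j j<a)

    v-injective : ∀ {x y} → v {M = M} x ≡ v y → x ≡ y
    v-injective refl = refl

    simple⁺ : ∀ i j → i ≤ 2 + a → j ≤ 2 + a → p⁺ i ≡ p⁺ j → i ≡ j
    simple⁺ zero          zero          _ _ _ = refl
    simple⁺ (suc zero)    (suc zero)    _ _ _ = refl
    simple⁺ (suc (suc i)) (suc (suc j)) (s≤s (s≤s i≤a)) (s≤s (s≤s j≤a)) e =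
      cong (2 +_) (simple i j i≤a j≤a (v-injective e))
    simple⁺ zero          (suc zero)    _ _ ()
    simple⁺ zero          (suc (suc _)) _ _ ()
    simple⁺ (suc zero)    zero          _ _ ()
    simple⁺ (suc zero)    (suc (suc _)) _ _ ()
    simple⁺ (suc (suc _)) zero          _ _ ()
    simple⁺ (suc (suc _)) (suc zero)    _ _ ()

    alt⁺ : ∀ i → 2 + i ≤ 2 + a →
           Alternate (M⁺ M (p⁺ i) (p⁺ (suc i))) (M⁺ M (p⁺ (suc i)) (p⁺ (2 + i)))
    alt⁺ zero          _                 = (λ ()) , (λ _ → wv start-U)
    alt⁺ (suc zero)    (s≤s (s≤s 1≤a)) =
      (λ { _ (old t) → subst T (matched 0 1≤a) t }) , (λ ¬wv → ⊥-elim (¬wv (wv start-U)))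
    alt⁺ (suc (suc j)) (s≤s (s≤s j+2≤a)) =
      Alternate-resp-⇔ M⁺-v⇔ M⁺-v⇔ (≡not⇒Alternate-T (begin
        m (p (suc j)) (p (2 + j)) ≡⟨ matched (suc j) j+2≤a ⟩
        isOdd (parity (suc j))     ≡⟨ isOdd-parity-suc j ⟩
        not (isOdd (parity j))     ≡⟨ cong not (matched j (<⇒≤ j+2≤a)) ⟨
        not (m (p j) (p (suc j)))  ∎))
      where open ≡-Reasoning

  module _ {k} (X : AugPath M k) where
    open AugPath X

    augPath-matched : ∀ i → i < k → m (p i) (p (suc i)) ≡ isOdd (parity i)
    augPath-matched zero    _     = ¬T⇒≡false first-nm
    augPath-matched (suc i) i+1<k = begin
      m (p (suc i)) (p (2 + i)) ≡⟨ Alternate-T⇒≡not (alt i i+1<k) ⟩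
      not (m (p i) (p (suc i))) ≡⟨ cong not (augPath-matched i (<⇒≤ i+1<k)) ⟩
      not (isOdd (parity i))    ≡⟨ isOdd-parity-suc i ⟨
      isOdd (parity (suc i))    ∎
      where open ≡-Reasoning

  augPath-odd : ∀ {k} → AugPath M k → parity k ≡ odd
  augPath-odd {zero}  X = ⊥-elim (AugPath.distinct X refl)
  augPath-odd {suc j} X = parity-suc-even j (isOdd≡false⇒even (begin
    isOdd (parity j)                        ≡⟨ augPath-matched X j ≤-refl ⟨
    m (AugPath.p X j) (AugPath.p X (suc j)) ≡⟨ ¬T⇒≡false (AugPath.last-nm X j refl) ⟩
    false                                   ∎))
    where open ≡-Reasoning

  module _ {k} (X : AugPath M k) where
    open AugPath X

    fromAugPath : AltPathFromUncovered (p k) k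
    fromAugPath = record
      { p = p ; start-U = start-U ; end = refl ; walk = walk ; simple = simple
      ; matched = augPath-matched X }

    fromReverseAugPath : AltPathFromUncovered (p 0) k
    fromReverseAugPath = record
      { p       = p ∘ (k ∸_)
      ; start-U = end-U
      ; end     = cong p (n∸n≡0 k)
      ; walk    = walkʳ
      ; simple  = λ i j i≤k j≤k e →
                    ∸-cancelˡ-≡ i≤k j≤k (simple (k ∸ i) (k ∸ j) (m∸n≤m k i) (m∸n≤m k j) e)
      ; matched = matchedʳ
      }
      where
      k∸j≡1+k∸[1+j] : ∀ {j} → j < k → k ∸ j ≡ suc (k ∸ suc j)
      k∸j≡1+k∸[1+j] = +-∸-assoc 1

      k∸[1+j]<k : ∀ {j} → j < k → k ∸ suc j < k
      k∸[1+j]<k {j} j<k = ≤-trans (≤-reflexive (sym (k∸j≡1+k∸[1+j] j<k))) (m∸n≤m k j)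

      walkʳ : ∀ j → j < k → T (adj (p (k ∸ j)) (p (k ∸ suc j)))
      walkʳ j j<k rewrite k∸j≡1+k∸[1+j] j<k | adj-sym (p (suc (k ∸ suc j))) (p (k ∸ suc j)) =
        walk (k ∸ suc j) (k∸[1+j]<k j<k)

      matchedʳ : ∀ j → j < k → m (p (k ∸ j)) (p (k ∸ suc j)) ≡ isOdd (parity j)
      matchedʳ j j<k rewrite k∸j≡1+k∸[1+j] j<k = begin
        m (p (suc (k ∸ suc j))) (p (k ∸ suc j)) ≡⟨ m-sym _ _ ⟩
        m (p (k ∸ suc j)) (p (suc (k ∸ suc j))) ≡⟨ augPath-matched X (k ∸ suc j) (k∸[1+j]<k j<k) ⟩
        isOdd (parity (k ∸ suc j))              ≡⟨ cong isOdd (parity-∸-suc j (augPath-odd X) j<k) ⟩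
        isOdd (parity j)                        ∎
        where open ≡-Reasoning

    augPath-prefix : ∀ i → i ≤ k → AltPath M (v (p i)) (2 + i)
    augPath-prefix i i≤k = toAltPath (take fromAugPath i i≤k)

    augPath-suffix : ∀ i → i ≤ k → AltPath M (v (p i)) (2 + (k ∸ i))
    augPath-suffix i i≤k = subst (λ x → AltPath M (v (p x)) (2 + (k ∸ i))) (m∸[m∸n]≡n i≤k)
      (toAltPath (take fromReverseAugPath (k ∸ i) (m∸n≤m k i)))

    augPath-vlevel-≤∞ : ∀ i → i < k → ∀ {L} → IsVlevel M (p i) (p (suc i)) L → L ≤∞ k + 4
    augPath-vlevel-≤∞ i i<k {L} vl = subst (L ≤∞_) lengths
      (IsVlevel-≤∞ vl (augPath-prefix i (<⇒≤ i<k)) (augPath-suffix (suc i) i<k) ρ≡i ρ≡k∸[1+i])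
      where
      ρ≡i : parity i ≡ ρ M (p i) (p (suc i))
      ρ≡i = sym (m≡isOdd⇒ρ≡ (parity i) (augPath-matched X i i<k))
      ρ≡k∸[1+i] : parity (k ∸ suc i) ≡ ρ M (p i) (p (suc i))
      ρ≡k∸[1+i] = trans (parity-∸-suc i (augPath-odd X) i<k) ρ≡i
      lengths : 2 + i + (2 + (k ∸ suc i)) + 1 ≡ k + 4
      lengths = trans (rearrange i (k ∸ suc i)) (cong (_+ 4) (m∸n+n≡m i<k))
        where
        rearrange : ∀ i c → 2 + i + (2 + c) + 1 ≡ c + suc i + 4
        rearrange = solve-∀

lemma8 : ∀ {n} {G : Graph n} (M : Matching G) (ℓ : ℕ) →
           (∀ k → AugPath M k → 2 * ℓ + 1 ≤ k) →
           (X : AugPath M (2 * ℓ + 1)) →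
           (∀ i → i < 2 * ℓ + 1 → ∀ L →
              IsVlevel M (AugPath.p X i) (AugPath.p X (suc i)) L →
              ¬ ((2 * ℓ + 5) <∞ L))
           × (∀ i → i ≤ 2 * ℓ + 1 → ∀ d →
              IsDistα M (v (AugPath.p X i)) d → ¬ ((ℓ + 2) <∞ d))
lemma8 M ℓ _ X = edge , vertex
  where
  k = 2 * ℓ + 1

  edge : ∀ i → i < k → ∀ L → IsVlevel M (AugPath.p X i) (AugPath.p X (suc i)) L →
         ¬ ((2 * ℓ + 5) <∞ L)
  edge i i<k L vl = ≤∞⇒≮∞ (augPath-vlevel-≤∞ M X i i<k vl) (≤-reflexive (+-assoc (2 * ℓ) 1 4))

  2+-≤ : ∀ {a} → a ≤ ℓ → 2 + a ≤ ℓ + 2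
  2+-≤ a≤ℓ = ≤-trans (s≤s (s≤s a≤ℓ)) (≤-reflexive (+-comm 2 ℓ))

  k∸i≤ℓ : ∀ {i} → ℓ < i → k ∸ i ≤ ℓ
  k∸i≤ℓ {i} ℓ<i = m≤n+o⇒m∸n≤o k i (≤-trans (≤-reflexive (k≡1+ℓ+ℓ ℓ)) (+-monoˡ-≤ ℓ ℓ<i))
    where
    k≡1+ℓ+ℓ : ∀ ℓ → 2 * ℓ + 1 ≡ suc ℓ + ℓ
    k≡1+ℓ+ℓ = solve-∀

  vertex : ∀ i → i ≤ k → ∀ d → IsDistα M (v (AugPath.p X i)) d → ¬ ((ℓ + 2) <∞ d)
  vertex i i≤k d dα with i ≤? ℓ
  ... | yes i≤ℓ = ≤∞⇒≮∞ (IsDistα-≤∞ M dα (augPath-prefix M X i i≤k)) (2+-≤ i≤ℓ)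
  ... | no  i≰ℓ = ≤∞⇒≮∞ (IsDistα-≤∞ M dα (augPath-suffix M X i i≤k)) (2+-≤ (k∸i≤ℓ (≰⇒> i≰ℓ)))
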